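{- Let $C$ be an $n\times n$ generalized conference matrix with minimal polynomial $z^2-\beta z-(n-1)$, and let $t\in\mathbb{C}\setminus\{0\}$. If $t+t^{ -1}+\beta=0$, then $tI+C$ is a type-II matrix.
   Context: An $n\times n$ matrix $C$ is a generalized conference matrix if $C$ is Hermitian, $C_{i,i}=0$ for all $i$, $|C_{i,j}|=1$ for $i\neq j$, and the minimal polynomial of $C$ is quadratic. For a matrix $W$ with all entries non-zero, $W^{(-)}$ denotes its entrywise inverse; an $n\times n$ such matrix is type-II if $W(W^{(-)})^T=nI$. -}

module Defs where

open import Level using (_⊔_)
open import Data.Nat using (ℕ; zero; suc)
open import Data.Fin using (Fin; zero; suc)
open import Data.Fin.Properties using (_≟_)
open import Data.Product using (Σ; _×_; ∃)
open import Relation.Nullary using (¬_; yes; no)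
open import Relation.Binary.PropositionalEquality using (_≡_)
open import Algebra.Bundles using (CommutativeRing)

module _ {c ℓ} (R : CommutativeRing c ℓ) where
  open CommutativeRing R hiding (zero)

  Matrix : ℕ → Set c
  Matrix n = Fin n → Fin n → Carrier

  sumF : (n : ℕ) → (Fin n → Carrier) → Carrier
  sumF zero    f = 0#
  sumF (suc n) f = f zero + sumF n (λ i → f (suc i))

  ι : ℕ → Carrier
  ι zero    = 0#
  ι (suc n) = 1# + ι n

  I : (n : ℕ) → Matrix n
  I n i j with i ≟ j
  ... | yes _ = 1#
  ... | no  _ = 0#

  _·M_ : {n : ℕ} → Matrix n → Matrix n → Matrix n
  _·M_ {n} A B i j = sumF n (λ k → A i k * B k j)

  _+M_ : {n : ℕ} → Matrix n → Matrix n → Matrix n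
  (A +M B) i j = A i j + B i j

  _*S_ : {n : ℕ} → Carrier → Matrix n → Matrix n
  (a *S A) i j = a * A i j

  transpose : {n : ℕ} → Matrix n → Matrix n
  transpose A i j = A j i

  _≈M_ : {n : ℕ} → Matrix n → Matrix n → Set ℓ
  A ≈M B = ∀ i j → A i j ≈ B i j

  -- an involutive ring automorphism (complex conjugation in the paper)
  record Conjugation : Set (c ⊔ ℓ) where
    field
      conj       : Carrier → Carrier
      conj-cong  : ∀ {x y} → x ≈ y → conj x ≈ conj y
      conj-invol : ∀ x → conj (conj x) ≈ x
      conj-+     : ∀ x y → conj (x + y) ≈ conj x + conj y
      conj-*     : ∀ x y → conj (x * y) ≈ conj x * conj y
      conj-1     : conj 1# ≈ 1#

  record IsGenConference (σ : Conjugation) (n : ℕ) (C : Matrix n) (β : Carrier) : Set (c ⊔ ℓ) where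
    open Conjugation σ
    field
      hermitian  : ∀ i j → C j i ≈ conj (C i j)
      diag-zero  : ∀ i → C i i ≈ 0#
      unimodular : ∀ i j → ¬ (i ≡ j) → C i j * conj (C i j) ≈ 1#
      -- z² - βz - (n-1) annihilates C ...
      annihilates : (C ·M C) ≈M ((β *S C) +M ((ι n - 1#) *S I n))
      -- ... and no monic polynomial of degree ≤ 1 does (so it is the minimal polynomial)
      not-scalar  : ¬ (Σ Carrier λ a → C ≈M (a *S I n))
      not-const   : ¬ (I n ≈M (0# *S I n))

  IsTypeII : {n : ℕ} → Matrix n → Set (c ⊔ ℓ)
  IsTypeII {n} W =
    Σ (Matrix n) λ V →
      (∀ i j → W i j * V i j ≈ 1#) × ((W ·M transpose V) ≈M (ι n *S I n))

-- Hermiticity turns the entrywise inverse of W = tI + C into t⁻¹I + Cᵀ, so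
-- W (W⁽⁻⁾)ᵀ = (tI + C)(t⁻¹I + C) = I + (t + t⁻¹) C + C².  Substituting
-- C² = βC + (n - 1) I from the minimal polynomial and t + t⁻¹ = -β leaves nI.
module Submission where

open import Defs
open import Data.Nat using (ℕ; zero; suc)
open import Data.Fin using (Fin; zero; suc)
open import Data.Fin.Properties using (_≟_; suc-injective)
open import Data.Product using (_,_)
open import Data.Empty using (⊥-elim)
open import Relation.Nullary using (¬_; Dec; yes; no)
open import Relation.Binary.PropositionalEquality as P using (_≡_)
open import Algebra.Bundles using (CommutativeRing)
import Algebra.Solver.Ring.NaturalCoefficients.Default as NaturalCoefficientsSolver
import Algebra.Properties.AbelianGroup as AbelianGroupProperties
import Algebra.Properties.CommutativeSemigroup as CommutativeSemigroupProperties
import Relation.Binary.Reasoning.Setoid as SetoidReasoning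

module MatrixAlgebra {c ℓ} (R : CommutativeRing c ℓ) where
  open CommutativeRing R hiding (zero)
  open NaturalCoefficientsSolver commutativeSemiring using (solve; _:=_; _:+_; _:*_)
  open CommutativeSemigroupProperties +-commutativeSemigroup
    using () renaming (interchange to +-interchange)
  open SetoidReasoning setoid

  I-diag : ∀ {n} (i j : Fin n) → i ≡ j → I R n i j ≈ 1#
  I-diag i j i≡j with i ≟ j
  ... | yes _   = refl
  ... | no  i≢j = ⊥-elim (i≢j i≡j)

  I-offdiag : ∀ {n} (i j : Fin n) → ¬ i ≡ j → I R n i j ≈ 0#
  I-offdiag i j i≢j with i ≟ j
  ... | yes i≡j = ⊥-elim (i≢j i≡j)
  ... | no  _   = refl

  I-sym : ∀ {n} (i j : Fin n) → I R n i j ≈ I R n j i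
  I-sym i j = by-cases (i ≟ j)
    where
    by-cases : Dec (i ≡ j) → I R _ i j ≈ I R _ j i
    by-cases (yes i≡j) = trans (I-diag i j i≡j) (sym (I-diag j i (P.sym i≡j)))
    by-cases (no  i≢j) = trans (I-offdiag i j i≢j) (sym (I-offdiag j i (λ j≡i → i≢j (P.sym j≡i))))

  I-suc : ∀ {n} (i j : Fin n) → I R (suc n) (suc i) (suc j) ≈ I R n i j
  I-suc i j = by-cases (i ≟ j)
    where
    by-cases : Dec (i ≡ j) → I R _ (suc i) (suc j) ≈ I R _ i j
    by-cases (yes i≡j) = trans (I-diag (suc i) (suc j) (P.cong suc i≡j)) (sym (I-diag i j i≡j))
    by-cases (no  i≢j) = trans (I-offdiag (suc i) (suc j) (λ si≡sj → i≢j (suc-injective si≡sj)))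
                               (sym (I-offdiag i j i≢j))

  sumF-cong : ∀ n {f g : Fin n → Carrier} → (∀ k → f k ≈ g k) → sumF R n f ≈ sumF R n g
  sumF-cong zero    f≈g = refl
  sumF-cong (suc n) f≈g = +-cong (f≈g zero) (sumF-cong n (λ k → f≈g (suc k)))

  sumF-+ : ∀ n (f g : Fin n → Carrier) →
           sumF R n (λ k → f k + g k) ≈ sumF R n f + sumF R n g
  sumF-+ zero    f g = sym (+-identityˡ 0#)
  sumF-+ (suc n) f g = begin
    (f zero + g zero) + sumF R n (λ k → f (suc k) + g (suc k))
      ≈⟨ +-congˡ (sumF-+ n _ _) ⟩
    (f zero + g zero) + (sumF R n (λ k → f (suc k)) + sumF R n (λ k → g (suc k)))
      ≈⟨ +-interchange _ _ _ _ ⟩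
    (f zero + sumF R n (λ k → f (suc k))) + (g zero + sumF R n (λ k → g (suc k))) ∎

  sumF-*ˡ : ∀ n (a : Carrier) (f : Fin n → Carrier) →
            sumF R n (λ k → a * f k) ≈ a * sumF R n f
  sumF-*ˡ zero    a f = sym (zeroʳ a)
  sumF-*ˡ (suc n) a f = trans (+-congˡ (sumF-*ˡ n a _)) (sym (distribˡ a _ _))

  sumF-zero : ∀ n (f : Fin n → Carrier) → (∀ k → f k ≈ 0#) → sumF R n f ≈ 0#
  sumF-zero zero    f f≈0 = refl
  sumF-zero (suc n) f f≈0 =
    trans (+-cong (f≈0 zero) (sumF-zero n _ (λ k → f≈0 (suc k)))) (+-identityˡ 0#)

  sumF-Iˡ : ∀ n (i : Fin n) (f : Fin n → Carrier) → sumF R n (λ k → I R n i k * f k) ≈ f i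
  sumF-Iˡ (suc n) zero f = begin
    I R (suc n) zero zero * f zero + sumF R n (λ k → I R (suc n) zero (suc k) * f (suc k))
      ≈⟨ +-cong (trans (*-congʳ (I-diag {suc n} zero zero P.refl)) (*-identityˡ _))
                (sumF-zero n _ (λ k → trans (*-congʳ (I-offdiag zero (suc k) (λ ()))) (zeroˡ _))) ⟩
    f zero + 0#
      ≈⟨ +-identityʳ _ ⟩
    f zero ∎
  sumF-Iˡ (suc n) (suc i) f = begin
    I R (suc n) (suc i) zero * f zero + sumF R n (λ k → I R (suc n) (suc i) (suc k) * f (suc k))
      ≈⟨ +-cong (trans (*-congʳ (I-offdiag (suc i) zero (λ ()))) (zeroˡ _))
                (sumF-cong n (λ k → *-congʳ (I-suc i k))) ⟩
    0# + sumF R n (λ k → I R n i k * f (suc k))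
      ≈⟨ +-identityˡ _ ⟩
    sumF R n (λ k → I R n i k * f (suc k))
      ≈⟨ sumF-Iˡ n i _ ⟩
    f (suc i) ∎

  sumF-Iʳ : ∀ n (j : Fin n) (f : Fin n → Carrier) → sumF R n (λ k → f k * I R n k j) ≈ f j
  sumF-Iʳ n j f =
    trans (sumF-cong n (λ k → trans (*-comm _ _) (*-congʳ (I-sym k j)))) (sumF-Iˡ n j f)

  ·M-congʳ : ∀ {n} (A : Matrix R n) {B B′ : Matrix R n} →
             _≈M_ R B B′ → _≈M_ R (_·M_ R A B) (_·M_ R A B′)
  ·M-congʳ {n} A B≈B′ i j = sumF-cong n (λ k → *-congˡ (B≈B′ k j))

  [aI+C]·[bI+C] : ∀ {n} (a b : Carrier) (C : Matrix R n) →
               _≈M_ R (_·M_ R (_+M_ R (_*S_ R a (I R n)) C) (_+M_ R (_*S_ R b (I R n)) C))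
                      (_+M_ R (_+M_ R (_*S_ R (a * b) (I R n)) (_*S_ R (a + b) C)) (_·M_ R C C))
  [aI+C]·[bI+C] {n} a b C i j = begin
    sumF R n (λ k → (a * I R n i k + C i k) * (b * I R n k j + C k j))
      ≈⟨ sumF-cong n (λ k → expand (I R n i k) (I R n k j) (C i k) (C k j)) ⟩
    sumF R n (λ k → ((a * b * (I R n i k * I R n k j) + a * (I R n i k * C k j))
                      + b * (C i k * I R n k j)) + C i k * C k j)
      ≈⟨ trans (sumF-+ n _ _) (+-congʳ (trans (sumF-+ n _ _) (+-congʳ (sumF-+ n _ _)))) ⟩
    ((sumF R n (λ k → a * b * (I R n i k * I R n k j)) + sumF R n (λ k → a * (I R n i k * C k j)))
      + sumF R n (λ k → b * (C i k * I R n k j))) + _·M_ R C C i j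
      ≈⟨ +-congʳ (+-cong (+-cong (pull-scalar (sumF-Iˡ n i _)) (pull-scalar (sumF-Iˡ n i _)))
                          (pull-scalar (sumF-Iʳ n j _))) ⟩
    ((a * b * I R n i j + a * C i j) + b * C i j) + _·M_ R C C i j
      ≈⟨ +-congʳ (trans (+-assoc _ _ _) (+-congˡ (sym (distribʳ (C i j) a b)))) ⟩
    (a * b * I R n i j + (a + b) * C i j) + _·M_ R C C i j ∎
    where
    expand : ∀ x y u v → (a * x + u) * (b * y + v) ≈
             ((a * b * (x * y) + a * (x * v)) + b * (u * y)) + u * v
    expand x y u v = solve 6 (λ a b x y u v → (a :* x :+ u) :* (b :* y :+ v) :=
                       a :* b :* (x :* y) :+ a :* (x :* v) :+ b :* (u :* y) :+ u :* v)
                       refl a b x y u v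
    pull-scalar : ∀ {s} {f : Fin n → Carrier} {x} → sumF R n f ≈ x →
                  sumF R n (λ k → s * f k) ≈ s * x
    pull-scalar {s} Σf≈x = trans (sumF-*ˡ n s _) (*-congˡ Σf≈x)

open MatrixAlgebra

module GenConference {c ℓ} (R : CommutativeRing c ℓ) (σ : Conjugation R) {n : ℕ}
                     {C : Matrix R n} {β : CommutativeRing.Carrier R}
                     (isGC : IsGenConference R σ n C β) where
  open CommutativeRing R hiding (zero)
  open NaturalCoefficientsSolver commutativeSemiring using (solve; _:=_; _:+_; _:*_)
  open AbelianGroupProperties +-abelianGroup using (xyx⁻¹≈y)
  open SetoidReasoning setoid
  open IsGenConference isGC
  open Conjugation σ

  tI+C-entrywise-inverse : ∀ {t t⁻¹} → t * t⁻¹ ≈ 1# → ∀ i j →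
    (t * I R n i j + C i j) * (t⁻¹ * I R n i j + C j i) ≈ 1#
  tI+C-entrywise-inverse {t} {t⁻¹} tt⁻¹≈1 i j with i ≟ j
  ... | yes P.refl = begin
    (t * 1# + C i i) * (t⁻¹ * 1# + C i i)
      ≈⟨ *-cong (+-cong (*-identityʳ t) (diag-zero i)) (+-cong (*-identityʳ t⁻¹) (diag-zero i)) ⟩
    (t + 0#) * (t⁻¹ + 0#)
      ≈⟨ *-cong (+-identityʳ t) (+-identityʳ t⁻¹) ⟩
    t * t⁻¹
      ≈⟨ tt⁻¹≈1 ⟩
    1# ∎
  ... | no i≢j = begin
    (t * 0# + C i j) * (t⁻¹ * 0# + C j i)
      ≈⟨ *-cong (+-congʳ (zeroʳ t)) (+-cong (zeroʳ t⁻¹) (hermitian i j)) ⟩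
    (0# + C i j) * (0# + conj (C i j))
      ≈⟨ *-cong (+-identityˡ _) (+-identityˡ _) ⟩
    C i j * conj (C i j)
      ≈⟨ unimodular i j i≢j ⟩
    1# ∎

  [tI+C]·[t⁻¹I+C]≈nI : ∀ {t t⁻¹} → t * t⁻¹ ≈ 1# → (t + t⁻¹) + β ≈ 0# →
    _≈M_ R (_·M_ R (_+M_ R (_*S_ R t (I R n)) C) (_+M_ R (_*S_ R t⁻¹ (I R n)) C))
           (_*S_ R (ι R n) (I R n))
  [tI+C]·[t⁻¹I+C]≈nI {t} {t⁻¹} tt⁻¹≈1 t+t⁻¹+β≈0 i j = begin
    _·M_ R (_+M_ R (_*S_ R t (I R n)) C) (_+M_ R (_*S_ R t⁻¹ (I R n)) C) i j
      ≈⟨ [aI+C]·[bI+C] R t t⁻¹ C i j ⟩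
    (t * t⁻¹ * I R n i j + (t + t⁻¹) * C i j) + _·M_ R C C i j
      ≈⟨ +-congˡ (annihilates i j) ⟩
    (t * t⁻¹ * I R n i j + (t + t⁻¹) * C i j) + (β * C i j + (ι R n - 1#) * I R n i j)
      ≈⟨ regroup (t * t⁻¹) (t + t⁻¹) β (ι R n - 1#) (I R n i j) (C i j) ⟩
    (t * t⁻¹ + (ι R n - 1#)) * I R n i j + ((t + t⁻¹) + β) * C i j
      ≈⟨ +-cong (*-congʳ (trans (+-congʳ tt⁻¹≈1) (1+[m-1]≈m (ι R n)))) (*-congʳ t+t⁻¹+β≈0) ⟩
    ι R n * I R n i j + 0# * C i j
      ≈⟨ trans (+-congˡ (zeroˡ _)) (+-identityʳ _) ⟩
    ι R n * I R n i j ∎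
    where
    regroup : ∀ p s b q x y → (p * x + s * y) + (b * y + q * x) ≈ (p + q) * x + (s + b) * y
    regroup p s b q x y = solve 6 (λ p s b q x y →
      (p :* x :+ s :* y) :+ (b :* y :+ q :* x) := (p :+ q) :* x :+ (s :+ b) :* y) refl p s b q x y
    1+[m-1]≈m : ∀ m → 1# + (m - 1#) ≈ m
    1+[m-1]≈m m = trans (sym (+-assoc 1# m (- 1#))) (xyx⁻¹≈y 1# m)

open GenConference

theorem7p3 : ∀ {c ℓ} (R : CommutativeRing c ℓ) (σ : Conjugation R) (n : ℕ)
               (C : Matrix R n) (β t t⁻¹ : CommutativeRing.Carrier R) →
               IsGenConference R σ n C β →
               CommutativeRing._≈_ R (CommutativeRing._*_ R t t⁻¹) (CommutativeRing.1# R) →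
               CommutativeRing._≈_ R
                 (CommutativeRing._+_ R (CommutativeRing._+_ R t t⁻¹) β)
                 (CommutativeRing.0# R) →
               IsTypeII R (_+M_ R (_*S_ R t (I R n)) C)
theorem7p3 R σ n C β t t⁻¹ isGC tt⁻¹≈1 t+t⁻¹+β≈0 =
  W⁽⁻⁾ , tI+C-entrywise-inverse R σ isGC tt⁻¹≈1 , W·W⁽⁻⁾ᵀ≈nI
  where
  open CommutativeRing R using (_*_; _+_; +-congʳ; *-congˡ; trans)
  W : Matrix R n
  W = _+M_ R (_*S_ R t (I R n)) C
  W⁽⁻⁾ : Matrix R n
  W⁽⁻⁾ i j = t⁻¹ * I R n i j + C j i
  W⁽⁻⁾ᵀ≈t⁻¹I+C : _≈M_ R (transpose R W⁽⁻⁾) (_+M_ R (_*S_ R t⁻¹ (I R n)) C)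
  W⁽⁻⁾ᵀ≈t⁻¹I+C i j = +-congʳ (*-congˡ (I-sym R j i))
  W·W⁽⁻⁾ᵀ≈nI : _≈M_ R (_·M_ R W (transpose R W⁽⁻⁾)) (_*S_ R (ι R n) (I R n))
  W·W⁽⁻⁾ᵀ≈nI i j = trans (·M-congʳ R W W⁽⁻⁾ᵀ≈t⁻¹I+C i j)
                         ([tI+C]·[t⁻¹I+C]≈nI R σ isGC tt⁻¹≈1 t+t⁻¹+β≈0 i j)
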